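{- Let $n\in\mathbb{N}$, $I$ a set of cardinality $n+1$, and $(G,(K_{\{i\}})_{i\in I})$ a subgroup geometry system; let $X=X(G,(K_{\{i\}})_{i\in I})$. For $-1\le k\le n$ let $I(k)=\{\tau\subseteq I : |\tau|=k+1\}$. Then the rule $f(\{gK_{\{i\}} : i\in\tau\})=gK_\tau$ gives a well-defined map $f: X(k)\to\{gK_\tau : g\in G, \tau\in I(k)\}$, which is bijective and $G$-equivariant, i.e. $f(g'.\{gK_{\{i\}}: i\in\tau\})=g'gK_\tau$ for all $g'\in G$. Furthermore, for all $\tau,\tau'\in\bigcup_{ -1\le k\le n}I(k)$ and $g,g'\in G$, $f^{ -1}(gK_\tau)\subseteq f^{ -1}(g'K_{\tau'})$ if and only if $\tau\subseteq\tau'$ and $(g')^{ -1}g\in K_\tau$.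
   Context: For a group $G$ with subgroups $K_{\{i\}}$, $i\in I$ ($I$ finite): $K_\tau=\bigcap_{i\in\tau}K_{\{i\}}$ for $\emptyset\neq\tau\subseteq I$, $K_\emptyset=G$. The coset complex $X(G,(K_{\{i\}})_{i\in I})$ has as vertices the cosets $gK_{\{i\}}$ ($g\in G$, $i\in I$; distinct $i$ give distinct vertices), two vertices $gK_{\{i\}},g'K_{\{j\}}$ spanning an edge iff $i\ne j$ and $gK_{\{i\}}\cap g'K_{\{j\}}\ne\emptyset$, and is the clique complex of this graph; $X(k)$ denotes its $k$-simplices ($X(-1)=\{\emptyset\}$); $G$ acts by $g.(g'K_{\{i\}})=gg'K_{\{i\}}$. It is a subgroup geometry system if (A1) $K_{\tau\cap\tau'}=\langle K_\tau,K_{\tau'}\rangle$ for all $\tau,\tau'\subseteq I$; (A2) $K_\tau K_{\{i\}}=\bigcap_{j\in\tau}K_{\{j\}}K_{\{i\}}$ for every $\tau\subsetneq I$, $i\in I\setminus\tau$; (A3) $K_I\ne K_{I\setminus\{i\}}$ for every $i\in I$. -}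

module Defs where

open import Level using (Level; _⊔_)
open import Algebra.Bundles using (Group)
open import Data.Nat using (ℕ; suc)
open import Data.Fin using (Fin)
open import Data.Fin.Subset using (Subset; _∈_; _∉_; _⊆_; _⊂_; _∩_; _-_; ⊤; ∣_∣)
open import Data.Product using (Σ; ∃; ∃-syntax; _×_; _,_; proj₁; proj₂)
open import Relation.Nullary using (¬_)
open import Relation.Binary.PropositionalEquality using (_≡_; _≢_)

_≐_ : ∀ {a p q} {A : Set a} → (A → Set p) → (A → Set q) → Set (a ⊔ p ⊔ q)
P ≐ Q = ∀ x → (P x → Q x) × (Q x → P x)

module _ {c ℓ : Level} (G : Group c ℓ) where
  open Group G hiding (_-_)

  record IsSubgroup {p} (P : Carrier → Set p) : Set (c ⊔ ℓ ⊔ p) where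
    field
      resp  : ∀ {x y} → x ≈ y → P x → P y
      ε∈    : P ε
      ∙∈    : ∀ {x y} → P x → P y → P (x ∙ y)
      ⁻¹∈   : ∀ {x} → P x → P (x ⁻¹)

  data Gen {p q} (P : Carrier → Set p) (Q : Carrier → Set q) : Carrier → Set (c ⊔ ℓ ⊔ p ⊔ q) where
    inP  : ∀ {x} → P x → Gen P Q x
    inQ  : ∀ {x} → Q x → Gen P Q x
    genε : Gen P Q ε
    gen∙ : ∀ {x y} → Gen P Q x → Gen P Q y → Gen P Q (x ∙ y)
    gen⁻¹ : ∀ {x} → Gen P Q x → Gen P Q (x ⁻¹)
    gen≈ : ∀ {x y} → x ≈ y → Gen P Q x → Gen P Q y

  _·_ : ∀ {p q} → (Carrier → Set p) → (Carrier → Set q) → Carrier → Set (c ⊔ ℓ ⊔ p ⊔ q)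
  (P · Q) x = Σ Carrier λ a → Σ Carrier λ b → P a × Q b × (x ≈ a ∙ b)

  Coset : ∀ {p} → Carrier → (Carrier → Set p) → Carrier → Set (c ⊔ ℓ ⊔ p)
  Coset g P x = Σ Carrier λ a → P a × (x ≈ g ∙ a)

  module _ {n : ℕ} {p : Level} (K : Fin (suc n) → Carrier → Set p) where

    Kτ : Subset (suc n) → Carrier → Set p
    Kτ τ x = ∀ i → i ∈ τ → K i x

    record IsSubgroupGeometrySystem : Set (c ⊔ ℓ ⊔ p) where
      field
        subgroups : ∀ i → IsSubgroup (K i)
        A1 : ∀ τ τ' → Kτ (τ ∩ τ') ≐ Gen (Kτ τ) (Kτ τ')
        A2 : ∀ τ i → τ ⊂ ⊤ → i ∉ τ →
             (Kτ τ · K i) ≐ (λ x → ∀ j → j ∈ τ → (K j · K i) x)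
        A3 : ∀ i → ¬ (Kτ ⊤ ≐ Kτ (⊤ - i))

    -- A vertex is a coset g K_i, represented by (i , g); vertices (i,g) and
    -- (j,h) are equal iff i ≡ j and g K_i = h K_i as subsets of G.
    -- A simplex with m vertices (an (m-1)-simplex) is a clique of the
    -- 1-skeleton; since adjacent vertices have distinct types, it is given by
    -- a type set τ with |τ| = m and one coset (rep i) K_i for each i ∈ τ,
    -- pairwise intersecting.

    record Simplex (m : ℕ) : Set (c ⊔ ℓ ⊔ p) where
      field
        τ     : Subset (suc n)
        size  : ∣ τ ∣ ≡ m
        rep   : ∀ i → i ∈ τ → Carrier
        clique : ∀ i j (pi : i ∈ τ) (pj : j ∈ τ) → i ≢ j →
                 ∃[ x ] (Coset (rep i pi) (K i) x × Coset (rep j pj) (K j) x)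
    open Simplex public

    _⊑_ : ∀ {m m'} → Simplex m → Simplex m' → Set (c ⊔ ℓ ⊔ p)
    σ ⊑ σ' = ∀ i (pi : i ∈ τ σ) → Σ (i ∈ τ σ') λ qi →
               Coset (rep σ i pi) (K i) ≐ Coset (rep σ' i qi) (K i)

    _≈ₛ_ : ∀ {m} → Simplex m → Simplex m → Set (c ⊔ ℓ ⊔ p)
    σ ≈ₛ σ' = (σ ⊑ σ') × (σ' ⊑ σ)

    act : ∀ {m} → Carrier → Simplex m → Simplex m
    act g σ = record
      { τ = τ σ ; size = size σ ; rep = λ i pi → g ∙ rep σ i pi
      ; clique = λ i j pi pj i≢j → cl i j pi pj i≢j }
      where
      cl : ∀ i j (pi : i ∈ τ σ) (pj : j ∈ τ σ) → i ≢ j →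
           ∃[ x ] (Coset (g ∙ rep σ i pi) (K i) x × Coset (g ∙ rep σ j pj) (K j) x)
      cl i j pi pj i≢j with clique σ i j pi pj i≢j
      ... | x , (a , Ka , x≈ra) , (b , Kb , x≈rb) =
        g ∙ x , (a , Ka , trans (∙-congˡ x≈ra) (sym (assoc g _ a)))
              , (b , Kb , trans (∙-congˡ x≈rb) (sym (assoc g _ b)))

    -- Cosets g K_τ with τ ∈ I(m-1), tagged by τ.
    record TCoset (m : ℕ) : Set c where
      constructor ⟨_,_,_⟩
      field
        ctype : Subset (suc n)
        csize : ∣ ctype ∣ ≡ m
        crep  : Carrier
    open TCoset public

    _≈c_ : ∀ {m} → TCoset m → TCoset m → Set (c ⊔ ℓ ⊔ p)
    C ≈c C' = (ctype C ≡ ctype C') ×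
              (Coset (crep C) (Kτ (ctype C)) ≐ Coset (crep C') (Kτ (ctype C')))

    actc : ∀ {m} → Carrier → TCoset m → TCoset m
    actc g ⟨ t , s , h ⟩ = ⟨ t , s , g ∙ h ⟩

-- A simplex {x_i K_i : i ∈ τ} is a family of pairwise intersecting cosets, and by (A2) such
-- cosets have a common point g (induction on τ, adding one coset at a time). Any two common
-- points differ by an element of K_τ = ⋂_{i∈τ} K_i, so the simplex determines g K_τ, and
-- conversely g K_τ determines the simplex {g K_i : i ∈ τ}. All remaining claims reduce to
-- g ∈ x K_i ⟺ x K_i = g K_i.
module Submission where

open import Defs
open import Level using (Level; _⊔_)
open import Algebra.Bundles using (Group)
import Algebra.Properties.Group as GroupProperties
open import Data.Empty using (⊥-elim)
open import Data.Nat using (ℕ; suc)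
open import Data.Fin using (Fin; _≟_)
open import Data.Fin.Subset using (Subset; _∈_; _∉_; _⊆_; _⊂_; _─_; _-_; ⊤; ⁅_⁆; ∣_∣; inside)
open import Data.Fin.Subset.Properties
  using (∈⊤; ⊆-reflexive; ⊆-antisym; nonempty?; p─q⊆p; x∈p⇒p-x⊂p; x∈p∧x≢y⇒x∈p-y; x∈⁅x⁆)
open import Data.Fin.Subset.Induction using (⊂-wellFounded; Acc; acc)
open import Data.Product using (Σ; ∃-syntax; _×_; _,_; proj₁; proj₂)
open import Data.Vec.Base using (_∷_; here; there)
open import Function.Bundles using (_⇔_; mk⇔; Equivalence)
open import Relation.Nullary using (yes; no)
open import Relation.Binary.PropositionalEquality using (_≡_; _≢_; refl; sym; cong; subst; subst₂)

∈-irrelevant : ∀ {n} {i : Fin n} {ρ : Subset n} (p q : i ∈ ρ) → p ≡ q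
∈-irrelevant here      here      = refl
∈-irrelevant (there p) (there q) = cong there (∈-irrelevant p q)

x∈p─q⇒x∉q : ∀ {n} {x : Fin n} (p q : Subset n) → x ∈ p ─ q → x ∉ q
x∈p─q⇒x∉q (_ ∷ p) (_ ∷ q) (there x∈p─q) (there x∈q) = x∈p─q⇒x∉q p q x∈p─q x∈q
x∈p─q⇒x∉q (_ ∷ p) (inside ∷ q) () here

x∈p-y⇒x≢y : ∀ {n} {x y : Fin n} (p : Subset n) → x ∈ p - y → x ≢ y
x∈p-y⇒x≢y {y = y} p x∈p-y refl = x∈p─q⇒x∉q p ⁅ y ⁆ x∈p-y (x∈⁅x⁆ y)

module _ {c ℓ : Level} (G : Group c ℓ) where
  open Group G hiding (_-_) renaming (refl to ≈-refl; sym to ≈-sym; trans to ≈-trans)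
  open GroupProperties G using (⁻¹-anti-homo-∙; ⁻¹-involutive; \\-leftDividesˡ; \\-leftDividesʳ)
  open import Relation.Binary.Reasoning.Setoid setoid

  infix 4 _~[_]_
  _~[_]_ : ∀ {p} → Carrier → (Carrier → Set p) → Carrier → Set p
  a ~[ P ] b = P (a ⁻¹ ∙ b)

  ⁻¹-∙-telescope : ∀ a b d → (a ⁻¹ ∙ b) ∙ (b ⁻¹ ∙ d) ≈ a ⁻¹ ∙ d
  ⁻¹-∙-telescope a b d = begin
    (a ⁻¹ ∙ b) ∙ (b ⁻¹ ∙ d)  ≈⟨ assoc _ _ _ ⟩
    a ⁻¹ ∙ (b ∙ (b ⁻¹ ∙ d))  ≈⟨ ∙-congˡ (\\-leftDividesˡ b d) ⟩
    a ⁻¹ ∙ d                 ∎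

  ~-∙-~ : ∀ {p q} {P : Carrier → Set p} {Q : Carrier → Set q} {a b d} →
          a ~[ P ] b → b ~[ Q ] d → _·_ G P Q (a ⁻¹ ∙ d)
  ~-∙-~ {a = a} {b} {d} r s = a ⁻¹ ∙ b , b ⁻¹ ∙ d , r , s , ≈-sym (⁻¹-∙-telescope a b d)

  ⋂-isSubgroup : ∀ {i p q} {I : Set i} {P : I → Carrier → Set p} (Q : I → Set q) →
                 (∀ i → IsSubgroup G (P i)) → IsSubgroup G (λ x → ∀ i → Q i → P i x)
  ⋂-isSubgroup Q P-subgroup = record
    { resp = λ x≈y Px i Qi → IsSubgroup.resp (P-subgroup i) x≈y (Px i Qi)
    ; ε∈   = λ i _ → IsSubgroup.ε∈ (P-subgroup i)
    ; ∙∈   = λ Px Py i Qi → IsSubgroup.∙∈ (P-subgroup i) (Px i Qi) (Py i Qi)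
    ; ⁻¹∈  = λ Px i Qi → IsSubgroup.⁻¹∈ (P-subgroup i) (Px i Qi)
    }

  module Cosets {p} {P : Carrier → Set p} (P-subgroup : IsSubgroup G P) where
    open IsSubgroup P-subgroup

    ~-intro : ∀ {a b k} → P k → b ≈ a ∙ k → a ~[ P ] b
    ~-intro {a} {b} {k} Pk b≈ak = resp (≈-sym (begin
      a ⁻¹ ∙ b        ≈⟨ ∙-congˡ b≈ak ⟩
      a ⁻¹ ∙ (a ∙ k)  ≈⟨ \\-leftDividesʳ a k ⟩
      k               ∎)) Pk

    ~-refl : ∀ a → a ~[ P ] a
    ~-refl a = resp (≈-sym (inverseˡ a)) ε∈

    ~-sym : ∀ {a b} → a ~[ P ] b → b ~[ P ] a
    ~-sym {a} {b} r =
      resp (≈-trans (⁻¹-anti-homo-∙ (a ⁻¹) b) (∙-congˡ (⁻¹-involutive a))) (⁻¹∈ r)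

    ~-trans : ∀ {a b d} → a ~[ P ] b → b ~[ P ] d → a ~[ P ] d
    ~-trans {a} {b} {d} r s = resp (⁻¹-∙-telescope a b d) (∙∈ r s)

    ∙-~ : ∀ g {a b} → a ~[ P ] b → g ∙ a ~[ P ] g ∙ b
    ∙-~ g {a} {b} r = resp (≈-sym (begin
      (g ∙ a) ⁻¹ ∙ (g ∙ b)     ≈⟨ ∙-congʳ (⁻¹-anti-homo-∙ g a) ⟩
      (a ⁻¹ ∙ g ⁻¹) ∙ (g ∙ b)  ≈⟨ assoc _ _ _ ⟩
      a ⁻¹ ∙ (g ⁻¹ ∙ (g ∙ b))  ≈⟨ ∙-congˡ (\\-leftDividesʳ g b) ⟩
      a ⁻¹ ∙ b                 ∎)) r

    coset⇒~ : ∀ {a b} → Coset G a P b → a ~[ P ] b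
    coset⇒~ (k , Pk , b≈ak) = ~-intro Pk b≈ak

    ~⇒coset : ∀ {a b} → a ~[ P ] b → Coset G a P b
    ~⇒coset {a} {b} r = a ⁻¹ ∙ b , r , ≈-sym (\\-leftDividesˡ a b)

    ~⇒coset≐ : ∀ {a b} → a ~[ P ] b → Coset G a P ≐ Coset G b P
    ~⇒coset≐ r x = (λ ax → ~⇒coset (~-trans (~-sym r) (coset⇒~ ax)))
                 , (λ bx → ~⇒coset (~-trans r (coset⇒~ bx)))

    coset≐⇒~ : ∀ {a b} → Coset G a P ≐ Coset G b P → a ~[ P ] b
    coset≐⇒~ {b = b} a≐b = coset⇒~ (proj₂ (a≐b b) (~⇒coset (~-refl b)))

  module _ {p : Level} {n : ℕ} (K : Fin (suc n) → Carrier → Set p) where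

    InAllCosets : (ρ : Subset (suc n)) → (∀ i → i ∈ ρ → Carrier) → Carrier → Set p
    InAllCosets ρ x g = ∀ i (i∈ρ : i ∈ ρ) → x i i∈ρ ~[ K i ] g

    PairwiseIntersecting : (ρ : Subset (suc n)) → (∀ i → i ∈ ρ → Carrier) → Set (c ⊔ p)
    PairwiseIntersecting ρ x = ∀ i j (i∈ρ : i ∈ ρ) (j∈ρ : j ∈ ρ) → i ≢ j →
      ∃[ z ] (x i i∈ρ ~[ K i ] z × x j j∈ρ ~[ K j ] z)

    module CommonPoint
      (K-subgroup : ∀ i → IsSubgroup G (K i))
      (A2 : ∀ τ i → τ ⊂ ⊤ → i ∉ τ →
            _·_ G (Kτ G K τ) (K i) ≐ (λ x → ∀ j → j ∈ τ → _·_ G (K j) (K i) x)) where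

      module Kᵢ i = Cosets (K-subgroup i)

      -- Induction on ρ: if g lies in the cosets indexed by ρ - i₀, (A2) writes g⁻¹ x i₀ = a b
      -- with a ∈ K_{ρ - i₀} and b ∈ K_{i₀}, and then g a lies in all cosets indexed by ρ.
      common-point : ∀ ρ (x : ∀ i → i ∈ ρ → Carrier) →
                     PairwiseIntersecting ρ x → ∃[ g ] InAllCosets ρ x g
      common-point ρ = go ρ (⊂-wellFounded ρ)
        where
        go : ∀ ρ → Acc _⊂_ ρ → (x : ∀ i → i ∈ ρ → Carrier) →
             PairwiseIntersecting ρ x → ∃[ g ] InAllCosets ρ x g
        go ρ (acc smaller) x meet with nonempty? ρ
        ... | no ρ-empty = ε , λ i i∈ρ → ⊥-elim (ρ-empty (i , i∈ρ))
        ... | yes (i₀ , i₀∈ρ) =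
          let (a , b , a∈Kρ′ , b∈Kᵢ₀ , g⁻¹x₀≈ab) = proj₂ (A2 ρ′ i₀ ρ′⊂⊤ i₀∉ρ′ (g ⁻¹ ∙ x₀)) g⁻¹x₀∈KⱼKᵢ₀
          in g ∙ a , extend a∈Kρ′ b∈Kᵢ₀ g⁻¹x₀≈ab
          where
          ρ′ = ρ - i₀
          ρ′⊆ρ : ρ′ ⊆ ρ
          ρ′⊆ρ = p─q⊆p ρ ⁅ i₀ ⁆
          i₀∉ρ′ : i₀ ∉ ρ′
          i₀∉ρ′ i₀∈ρ′ = x∈p-y⇒x≢y ρ i₀∈ρ′ refl
          ρ′⊂⊤ : ρ′ ⊂ ⊤
          ρ′⊂⊤ = (λ _ → ∈⊤) , i₀ , ∈⊤ , i₀∉ρ′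

          x′ : ∀ i → i ∈ ρ′ → Carrier
          x′ i i∈ρ′ = x i (ρ′⊆ρ i∈ρ′)
          x₀ = x i₀ i₀∈ρ

          IH : ∃[ g ] InAllCosets ρ′ x′ g
          IH = go ρ′ (smaller (x∈p⇒p-x⊂p i₀∈ρ)) x′ (λ i j i∈ρ′ j∈ρ′ → meet i j (ρ′⊆ρ i∈ρ′) (ρ′⊆ρ j∈ρ′))
          g = proj₁ IH

          g⁻¹x₀∈KⱼKᵢ₀ : ∀ j → j ∈ ρ′ → _·_ G (K j) (K i₀) (g ⁻¹ ∙ x₀)
          g⁻¹x₀∈KⱼKᵢ₀ j j∈ρ′ with meet j i₀ (ρ′⊆ρ j∈ρ′) i₀∈ρ (x∈p-y⇒x≢y ρ j∈ρ′)
          ... | z , xⱼ~z , x₀~z =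
            ~-∙-~ (Kᵢ.~-trans j (Kᵢ.~-sym j (proj₂ IH j j∈ρ′)) xⱼ~z) (Kᵢ.~-sym i₀ x₀~z)

          extend : ∀ {a b} → Kτ G K ρ′ a → K i₀ b → g ⁻¹ ∙ x₀ ≈ a ∙ b → InAllCosets ρ x (g ∙ a)
          extend {a} {b} a∈Kρ′ b∈Kᵢ₀ g⁻¹x₀≈ab i i∈ρ with i ≟ i₀
          ... | yes refl =
            subst (λ i₀∈ρ → x i₀ i₀∈ρ ~[ K i₀ ] g ∙ a) (∈-irrelevant i₀∈ρ i∈ρ)
              (Kᵢ.~-sym i₀ (Kᵢ.~-intro i₀ b∈Kᵢ₀ x₀≈gab))
            where
            x₀≈gab : x₀ ≈ (g ∙ a) ∙ b
            x₀≈gab = begin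
              x₀                ≈⟨ \\-leftDividesˡ g x₀ ⟨
              g ∙ (g ⁻¹ ∙ x₀)   ≈⟨ ∙-congˡ g⁻¹x₀≈ab ⟩
              g ∙ (a ∙ b)       ≈⟨ assoc g a b ⟨
              (g ∙ a) ∙ b       ∎
          ... | no i≢i₀ =
            subst (λ i∈ρ → x i i∈ρ ~[ K i ] g ∙ a) (∈-irrelevant _ i∈ρ)
              (Kᵢ.~-trans i (proj₂ IH i i∈ρ′) (Kᵢ.~-intro i (a∈Kρ′ i i∈ρ′) ≈-refl))
            where i∈ρ′ = x∈p∧x≢y⇒x∈p-y i∈ρ i≢i₀

    module GeometrySystem (S : IsSubgroupGeometrySystem G K) where
      open IsSubgroupGeometrySystem S
      open CommonPoint subgroups A2 using (common-point)

      module Kᵢ i = Cosets (subgroups i)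
      module Kτ-cosets τ = Cosets (⋂-isSubgroup (_∈ τ) subgroups)

      -- σ = {g K_i : i ∈ τ σ}
      BasedAt : ∀ {m} → Simplex G K m → Carrier → Set p
      BasedAt σ = InAllCosets (τ σ) (rep σ)

      clique-intersecting : ∀ {m} (σ : Simplex G K m) → PairwiseIntersecting (τ σ) (rep σ)
      clique-intersecting σ i j i∈τ j∈τ i≢j with clique σ i j i∈τ j∈τ i≢j
      ... | z , z∈cosetᵢ , z∈cosetⱼ = z , Kᵢ.coset⇒~ i z∈cosetᵢ , Kᵢ.coset⇒~ j z∈cosetⱼ

      basepoint : ∀ {m} → Simplex G K m → Carrier
      basepoint σ = proj₁ (common-point (τ σ) (rep σ) (clique-intersecting σ))

      basepoint-based : ∀ {m} (σ : Simplex G K m) → BasedAt σ (basepoint σ)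
      basepoint-based σ = proj₂ (common-point (τ σ) (rep σ) (clique-intersecting σ))

      cosetOf : ∀ m → Simplex G K m → TCoset G K m
      cosetOf m σ = ⟨ τ σ , size σ , basepoint σ ⟩

      based-unique : ∀ {m} (σ : Simplex G K m) {g h} →
                     BasedAt σ g → BasedAt σ h → g ~[ Kτ G K (τ σ) ] h
      based-unique σ σ∋g σ∋h i i∈τ = Kᵢ.~-trans i (Kᵢ.~-sym i (σ∋g i i∈τ)) (σ∋h i i∈τ)

      based-resp : ∀ {m} (σ : Simplex G K m) {g h} →
                   BasedAt σ g → g ~[ Kτ G K (τ σ) ] h → BasedAt σ h
      based-resp σ σ∋g g~h i i∈τ = Kᵢ.~-trans i (σ∋g i i∈τ) (g~h i i∈τ)

      ⊑⇒⊆ : ∀ {m m′} (σ : Simplex G K m) (σ′ : Simplex G K m′) → _⊑_ G K σ σ′ → τ σ ⊆ τ σ′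
      ⊑⇒⊆ σ σ′ σ⊑σ′ i∈τ = proj₁ (σ⊑σ′ _ i∈τ)

      ⊑-based : ∀ {m m′} (σ : Simplex G K m) (σ′ : Simplex G K m′) {g} →
                _⊑_ G K σ σ′ → BasedAt σ′ g → BasedAt σ g
      ⊑-based σ σ′ σ⊑σ′ σ′∋g i i∈τ with σ⊑σ′ i i∈τ
      ... | i∈τ′ , same-coset = Kᵢ.~-trans i (Kᵢ.coset≐⇒~ i same-coset) (σ′∋g i i∈τ′)

      based-⊑ : ∀ {m m′} (σ : Simplex G K m) (σ′ : Simplex G K m′) {g} →
                τ σ ⊆ τ σ′ → BasedAt σ g → BasedAt σ′ g → _⊑_ G K σ σ′
      based-⊑ σ σ′ τ⊆τ′ σ∋g σ′∋g i i∈τ =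
        τ⊆τ′ i∈τ , Kᵢ.~⇒coset≐ i (Kᵢ.~-trans i (σ∋g i i∈τ) (Kᵢ.~-sym i (σ′∋g i (τ⊆τ′ i∈τ))))

      cosetOf-≈c⇔ : ∀ {m} (σ : Simplex G K m) (C : TCoset G K m) →
                    _≈c_ G K (cosetOf m σ) C ⇔ (τ σ ≡ ctype C × BasedAt σ (crep C))
      cosetOf-≈c⇔ σ ⟨ t , s , h ⟩ = mk⇔ to from
        where
        to : _≈c_ G K (cosetOf _ σ) ⟨ t , s , h ⟩ → τ σ ≡ t × BasedAt σ h
        to (refl , same-coset) =
          refl , based-resp σ (basepoint-based σ) (Kτ-cosets.coset≐⇒~ t same-coset)
        from : τ σ ≡ t × BasedAt σ h → _≈c_ G K (cosetOf _ σ) ⟨ t , s , h ⟩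
        from (refl , σ∋h) = refl , Kτ-cosets.~⇒coset≐ t (based-unique σ (basepoint-based σ) σ∋h)

      ⊑⇔ : ∀ {m m′} (σ : Simplex G K m) (σ′ : Simplex G K m′) {g g′} →
           BasedAt σ g → BasedAt σ′ g′ →
           _⊑_ G K σ σ′ ⇔ (τ σ ⊆ τ σ′ × g′ ~[ Kτ G K (τ σ) ] g)
      ⊑⇔ σ σ′ {g} {g′} σ∋g σ′∋g′ = mk⇔ to from
        where
        to : _⊑_ G K σ σ′ → τ σ ⊆ τ σ′ × g′ ~[ Kτ G K (τ σ) ] g
        to σ⊑σ′ = ⊑⇒⊆ σ σ′ σ⊑σ′ , based-unique σ (⊑-based σ σ′ σ⊑σ′ σ′∋g′) σ∋g
        from : τ σ ⊆ τ σ′ × g′ ~[ Kτ G K (τ σ) ] g → _⊑_ G K σ σ′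
        from (τ⊆τ′ , g′~g) = based-⊑ σ σ′ τ⊆τ′ (based-resp σ σ∋g (Kτ-cosets.~-sym (τ σ) g′~g)) σ′∋g′

      constant-simplex : ∀ {m} → TCoset G K m → Simplex G K m
      constant-simplex ⟨ t , size-t , h ⟩ = record
        { τ = t ; size = size-t ; rep = λ _ _ → h
        ; clique = λ i j _ _ _ → h , Kᵢ.~⇒coset i (Kᵢ.~-refl i h) , Kᵢ.~⇒coset j (Kᵢ.~-refl j h) }

      constant-simplex-based : ∀ {m} (C : TCoset G K m) → BasedAt (constant-simplex C) (crep C)
      constant-simplex-based C i _ = Kᵢ.~-refl i (crep C)

proposition2p6 : ∀ {c ℓ p : Level} (n : ℕ) (G : Group c ℓ)
    (K : Fin (suc n) → Group.Carrier G → Set p) →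
    IsSubgroupGeometrySystem G K →
    Σ (∀ m → Simplex G K m → TCoset G K m) λ f →
      -- defining rule: f {g K_i : i ∈ τ} = g K_τ
      (∀ m (σ : Simplex G K m) (g : Group.Carrier G) →
         (∀ i (pi : i ∈ τ σ) → _≐_ (Coset G (rep σ i pi) (K i)) (Coset G g (K i))) →
         _≈c_ G K (f m σ) ⟨ τ σ , size σ , g ⟩)
      -- well defined
      × (∀ m (σ σ' : Simplex G K m) → _≈ₛ_ G K σ σ' → _≈c_ G K (f m σ) (f m σ'))
      -- injective
      × (∀ m (σ σ' : Simplex G K m) → _≈c_ G K (f m σ) (f m σ') → _≈ₛ_ G K σ σ')
      -- surjective
      × (∀ m (C : TCoset G K m) → ∃[ σ ] _≈c_ G K (f m σ) C)
      -- G-equivariant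
      × (∀ m (g : Group.Carrier G) (σ : Simplex G K m) →
           _≈c_ G K (f m (act G K g σ)) (actc G K g (f m σ)))
      -- f⁻¹(g K_τ) ⊆ f⁻¹(g' K_τ') iff τ ⊆ τ' and g'⁻¹ g ∈ K_τ
      × (∀ (τ₁ τ₂ : Subset (suc n)) (g g' : Group.Carrier G)
           (σ : Simplex G K _) (σ' : Simplex G K _) →
           _≈c_ G K (f _ σ) ⟨ τ₁ , refl , g ⟩ →
           _≈c_ G K (f _ σ') ⟨ τ₂ , refl , g' ⟩ →
           (_⊑_ G K σ σ' ⇔ (τ₁ ⊆ τ₂ × Kτ G K τ₁ (Group._∙_ G (Group._⁻¹ G g') g))))
proposition2p6 n G K S =
  cosetOf ,
  (λ m σ g σ≐g → from (cosetOf-≈c⇔ σ ⟨ τ σ , size σ , g ⟩) (refl , λ i i∈τ → Kᵢ.coset≐⇒~ i (σ≐g i i∈τ))) ,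
  (λ m σ σ′ (σ⊑σ′ , σ′⊑σ) → from (cosetOf-≈c⇔ σ (cosetOf m σ′))
     (⊆-antisym (⊑⇒⊆ σ σ′ σ⊑σ′) (⊑⇒⊆ σ′ σ σ′⊑σ) , ⊑-based σ σ′ σ⊑σ′ (basepoint-based σ′))) ,
  (λ m σ σ′ fσ≈fσ′ → let (τ≡τ′ , σ∋g′) = to (cosetOf-≈c⇔ σ (cosetOf m σ′)) fσ≈fσ′ in
     based-⊑ σ σ′ (⊆-reflexive τ≡τ′) σ∋g′ (basepoint-based σ′) ,
     based-⊑ σ′ σ (⊆-reflexive (sym τ≡τ′)) (basepoint-based σ′) σ∋g′) ,
  (λ m C → constant-simplex C ,
     from (cosetOf-≈c⇔ (constant-simplex C) C) (refl , constant-simplex-based C)) ,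
  (λ m g σ → from (cosetOf-≈c⇔ (act G K g σ) (actc G K g (cosetOf m σ)))
     (refl , λ i i∈τ → Kᵢ.∙-~ i g (basepoint-based σ i i∈τ))) ,
  (λ τ₁ τ₂ g g′ σ σ′ fσ≈gKτ₁ fσ′≈g′Kτ₂ →
     let (τ≡τ₁ , σ∋g) = to (cosetOf-≈c⇔ σ ⟨ τ₁ , refl , g ⟩) fσ≈gKτ₁
         (τ′≡τ₂ , σ′∋g′) = to (cosetOf-≈c⇔ σ′ ⟨ τ₂ , refl , g′ ⟩) fσ′≈g′Kτ₂
     in subst₂ (λ t t′ → _⊑_ G K σ σ′ ⇔ (t ⊆ t′ × Kτ G K t (g′ ⁻¹ ∙ g)))
               τ≡τ₁ τ′≡τ₂ (⊑⇔ σ σ′ σ∋g σ′∋g′))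
  where
  open Group G using (_∙_; _⁻¹)
  open GeometrySystem G K S
  open Equivalence using (to; from)
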